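{- Let $n \ge 2$ and let $S \subseteq \{0,1\}^n$. For every $x \in \overline{S}$ there exists $v^* \in S$ with $\|x - v^*\|_\infty \le 1 - \frac{1}{n}$.
   Context: $\overline{S}$ denotes the convex hull of $S$.
   Formalization: The point $x$ has rational coordinates and is written as a convex combination of points of $S$ with rational weights. -}

module Defs where

open import Data.Nat using (ℕ; zero; suc)
open import Data.Integer using (+_)
open import Data.Fin using (Fin)
open import Data.Bool using (Bool; true; false)
open import Data.List using (List; map; foldr)
open import Data.List.Relation.Unary.All using (All)
open import Data.Product using (_×_; proj₁; proj₂)
open import Data.Rational using (ℚ; 0ℚ; 1ℚ; _+_; _*_; _-_; _≤_; ∣_∣; _/_)
open import Relation.Binary.PropositionalEquality using (_≡_)

bit : Bool → ℚ
bit true  = 1ℚ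
bit false = 0ℚ

embed : {n : ℕ} → (Fin n → Bool) → Fin n → ℚ
embed v i = bit (v i)

-- 1/n (only used for n ≥ 2; the value at 0 is irrelevant)
inv : ℕ → ℚ
inv zero    = 0ℚ
inv (suc k) = (+ 1) / suc k

sumℚ : List ℚ → ℚ
sumℚ = foldr _+_ 0ℚ

-- x lies in the convex hull of S ⊆ {0,1}^n: x is a finite convex combination
-- of points of S (given as a list of (weight, point) pairs).
record InHull {n : ℕ} (S : (Fin n → Bool) → Set) (x : Fin n → ℚ) : Set where
  field
    pts    : List (ℚ × (Fin n → Bool))
    inS    : All (λ p → S (proj₂ p)) pts
    nonneg : All (λ p → 0ℚ ≤ proj₁ p) pts
    sum1   : sumℚ (map proj₁ pts) ≡ 1ℚ
    comb   : ∀ i → x i ≡ sumℚ (map (λ p → proj₁ p * embed (proj₂ p) i) pts)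

SupDistLe : {n : ℕ} → (Fin n → ℚ) → (Fin n → ℚ) → ℚ → Set
SupDistLe x y c = ∀ i → ∣ x i - y i ∣ ≤ c

{-# OPTIONS --safe #-}
module Submission where

-- Write x as a convex combination of points of S and let m = 1/n, so m ≤ 1 - m as n ≥ 2.
-- In each coordinate i the points v with |x_i - v_i| > 1 - m carry weight < m: if x_i < m,
-- only points with v_i = 1 are that far, and together they weigh x_i; if x_i > 1 - m, only
-- points with v_i = 0, weighing 1 - x_i; otherwise no point is.  By the union bound the
-- points far from x in some coordinate weigh < n m = 1, so some point of the combination is
-- within 1 - m of x in every coordinate.

open import Defs
open import Level using (Level; 0ℓ)
open import Data.Nat using (ℕ; _≤_; zero; suc; NonZero; s≤s; z≤n)
open import Data.Fin using (Fin; zero; suc; punchIn)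
open import Data.Fin.Properties using (all?; ¬∀⟶∃¬)
open import Data.Bool using (Bool; true; false; T; if_then_else_)
open import Data.Empty using (⊥-elim)
open import Data.Integer as ℤ using (+_)
import Data.Integer.Properties as ℤ
open import Data.List using (List; []; _∷_; map)
open import Data.List.Properties using (map-cong)
open import Data.List.Relation.Unary.All using (All; []; _∷_; lookupAny; search)
import Data.List.Relation.Unary.All as All
open import Data.List.Relation.Unary.Any using (Any)
open import Data.Product using (Σ; ∃; _×_; _,_; proj₁; proj₂)
open import Data.Sum using ([_,_]′)
open import Function using (_∘_)
open import Data.Unit using (tt)
open import Data.Rational
  using (ℚ; 0ℚ; 1ℚ; _+_; _*_; _-_; -_; ∣_∣; _/_; toℚᵘ)
  renaming (_≤_ to _≤ℚ_; _<_ to _<ℚ_)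
open import Data.Rational.Properties
import Data.Rational.Unnormalised as ℚᵘ
import Data.Rational.Unnormalised.Properties as ℚᵘ
open import Data.Rational.Solver using (module +-*-Solver)
open import Data.Vec.Functional using (removeAt)
open import Algebra.Properties.CommutativeMonoid.Sum +-0-commutativeMonoid
  using (sum; sum-syntax; ∑-distrib-+; sum-remove; sum-replicate-zero)
open import Relation.Nullary using (yes; no; ¬_; does)
open import Relation.Nullary.Decidable using (T?)
open import Relation.Unary using (Pred; Decidable; Empty; _⊆_; ∁)
open import Relation.Unary.Properties using (∁?)
open import Relation.Binary.PropositionalEquality
  using (_≡_; refl; sym; trans; cong; cong₂; subst; subst₂; module ≡-Reasoning)
import Relation.Binary.Reasoning.Setoid as SetoidReasoning

private
  variable
    ℓ : Level
    A : Set
    n : ℕ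
    m p q : ℚ

p≤p+q : 0ℚ ≤ℚ q → p ≤ℚ p + q
p≤p+q {q} {p} 0≤q = subst (_≤ℚ p + q) (+-identityʳ p) (+-monoʳ-≤ p 0≤q)

p≤q⇒0≤q-p : p ≤ℚ q → 0ℚ ≤ℚ q - p
p≤q⇒0≤q-p {p} {q} p≤q = subst (_≤ℚ q - p) (+-inverseʳ p) (+-monoˡ-≤ (- p) p≤q)

∣p-1∣≡1-p : p ≤ℚ 1ℚ → ∣ p - 1ℚ ∣ ≡ 1ℚ - p
∣p-1∣≡1-p {p} p≤1 = begin
  ∣ p - 1ℚ ∣       ≡⟨ sym (∣-p∣≡∣p∣ (p - 1ℚ)) ⟩
  ∣ - (p - 1ℚ) ∣   ≡⟨ cong ∣_∣ (solve 1 (λ p → :- (p :- con 1ℚ) := con 1ℚ :- p) refl p) ⟩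
  ∣ 1ℚ - p ∣       ≡⟨ 0≤p⇒∣p∣≡p (p≤q⇒0≤q-p p≤1) ⟩
  1ℚ - p           ∎
  where open ≡-Reasoning; open +-*-Solver

1-q<p⇒1-p<q : 1ℚ - q <ℚ p → 1ℚ - p <ℚ q
1-q<p⇒1-p<q {q} {p} 1-q<p =
  subst (1ℚ - p <ℚ_) (solve 1 (λ q → con 1ℚ :- (con 1ℚ :- q) := q) refl q)
    (+-monoʳ-< 1ℚ (neg-antimono-< 1-q<p))
  where open +-*-Solver

p+q≡r⇒q≡r-p : ∀ {r} → p + q ≡ r → q ≡ r - p
p+q≡r⇒q≡r-p {p} {q} p+q≡r =
  trans (solve 2 (λ p q → q := (p :+ q) :- p) refl p q) (cong (_- p) p+q≡r)
  where open +-*-Solver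

p+p≤1⇒p≤1-p : p + p ≤ℚ 1ℚ → p ≤ℚ 1ℚ - p
p+p≤1⇒p≤1-p {p} p+p≤1 =
  subst (_≤ℚ 1ℚ - p) (solve 1 (λ p → (p :+ p) :- p := p) refl p) (+-monoˡ-≤ (- p) p+p≤1)
  where open +-*-Solver

Weighted : Set → Set
Weighted A = List (ℚ × A)

total : Weighted A → ℚ
total L = sumℚ (map proj₁ L)

NonNegWeights : Weighted A → Set
NonNegWeights = All (λ p → 0ℚ ≤ℚ proj₁ p)

weight : {P : Pred A ℓ} → Decidable P → ℚ × A → ℚ
weight P? (w , x) = if does (P? x) then w else 0ℚ

mass : {P : Pred A ℓ} → Decidable P → Weighted A → ℚ
mass P? L = sumℚ (map (weight P?) L)

module _ {P : Pred A ℓ} (P? : Decidable P) where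

  weight-nonneg : ∀ {w} x → 0ℚ ≤ℚ w → 0ℚ ≤ℚ weight P? (w , x)
  weight-nonneg x 0≤w with P? x
  ... | yes _ = 0≤w
  ... | no  _ = ≤-refl

  weight-∈ : ∀ {w x} → P x → weight P? (w , x) ≡ w
  weight-∈ {x = x} px with P? x
  ... | yes _   = refl
  ... | no  ¬px = ⊥-elim (¬px px)

  weight-∉ : ∀ {w x} → ¬ P x → weight P? (w , x) ≡ 0ℚ
  weight-∉ {x = x} ¬px with P? x
  ... | yes px = ⊥-elim (¬px px)
  ... | no  _  = refl

  weight-+-weight-∁ : ∀ w x → weight P? (w , x) + weight (∁? P?) (w , x) ≡ w
  weight-+-weight-∁ w x with P? x
  ... | yes _ = +-identityʳ w
  ... | no  _ = +-identityˡ w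

  weight-mono : ∀ {Q : Pred A ℓ} (Q? : Decidable Q) → P ⊆ Q →
                ∀ {w} x → 0ℚ ≤ℚ w → weight P? (w , x) ≤ℚ weight Q? (w , x)
  weight-mono Q? P⊆Q x 0≤w with P? x | Q? x
  ... | yes _  | yes _  = ≤-refl
  ... | yes px | no ¬qx = ⊥-elim (¬qx (P⊆Q px))
  ... | no  _  | yes _  = 0≤w
  ... | no  _  | no  _  = ≤-refl

  mass-nonneg : ∀ {L : Weighted A} → NonNegWeights L → 0ℚ ≤ℚ mass P? L
  mass-nonneg []                          = ≤-refl
  mass-nonneg {(w , x) ∷ L} (0≤w ∷ 0≤ws) = +-mono-≤ (weight-nonneg x 0≤w) (mass-nonneg 0≤ws)

  mass-mono : ∀ {Q : Pred A ℓ} (Q? : Decidable Q) → P ⊆ Q →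
              ∀ {L : Weighted A} → NonNegWeights L → mass P? L ≤ℚ mass Q? L
  mass-mono Q? P⊆Q []                          = ≤-refl
  mass-mono Q? P⊆Q {(w , x) ∷ L} (0≤w ∷ 0≤ws) =
    +-mono-≤ (weight-mono Q? P⊆Q x 0≤w) (mass-mono Q? P⊆Q 0≤ws)

  mass-∅ : Empty P → (L : Weighted A) → mass P? L ≡ 0ℚ
  mass-∅ ∅ []            = refl
  mass-∅ ∅ ((w , x) ∷ L) = cong₂ _+_ (weight-∉ (∅ x)) (mass-∅ ∅ L)

  mass-+-mass-∁ : (L : Weighted A) → mass P? L + mass (∁? P?) L ≡ total L
  mass-+-mass-∁ []            = +-identityʳ 0ℚ
  mass-+-mass-∁ ((w , x) ∷ L) = begin
    (a + M) + (b + N)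
      ≡⟨ solve 4 (λ a M b N → (a :+ M) :+ (b :+ N) := (a :+ b) :+ (M :+ N)) refl a M b N ⟩
    (a + b) + (M + N)   ≡⟨ cong₂ _+_ (weight-+-weight-∁ w x) (mass-+-mass-∁ L) ⟩
    w + total L         ∎
    where
    open ≡-Reasoning; open +-*-Solver
    a b M N : ℚ
    a = weight P? (w , x)
    b = weight (∁? P?) (w , x)
    M = mass P? L
    N = mass (∁? P?) L

mean : (A → Bool) → Weighted A → ℚ
mean f L = sumℚ (map (λ p → proj₁ p * bit (f (proj₂ p))) L)

*-bit : ∀ w b → w * bit b ≡ (if b then w else 0ℚ)
*-bit w true  = *-identityʳ w
*-bit w false = *-zeroʳ w

mean≡mass : (f : A → Bool) (L : Weighted A) → mean f L ≡ mass (λ x → T? (f x)) L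
mean≡mass f L = cong sumℚ (map-cong (λ p → *-bit (proj₁ p) (f (proj₂ p))) L)

Near : ℚ → ℚ → Pred Bool 0ℓ
Near c a b = ∣ a - bit b ∣ ≤ℚ c

near? : ∀ c a → Decidable (Near c a)
near? c a b = ∣ a - bit b ∣ ≤? c

Far : ℚ → ℚ → Pred Bool 0ℓ
Far c a = ∁ (Near c a)

far? : ∀ c a → Decidable (Far c a)
far? c a = ∁? (near? c a)

near-false : ∀ {a c} → 0ℚ ≤ℚ a → a ≤ℚ c → Near c a false
near-false {a} 0≤a a≤c =
  subst (_≤ℚ _) (sym (trans (cong ∣_∣ (+-identityʳ a)) (0≤p⇒∣p∣≡p 0≤a))) a≤c

near-true : ∀ {a} → m ≤ℚ a → a ≤ℚ 1ℚ → Near (1ℚ - m) a true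
near-true m≤a a≤1 =
  subst (_≤ℚ _) (sym (∣p-1∣≡1-p a≤1)) (+-monoʳ-≤ 1ℚ (neg-antimono-≤ m≤a))

module _ {a c : ℚ} where

  far⇒T : Near c a false → Far c a ⊆ T
  far⇒T near0 {false} far = far near0
  far⇒T near0 {true}  far = tt

  far⇒¬T : Near c a true → Far c a ⊆ ∁ T
  far⇒¬T near1 {true}  far _ = far near1
  far⇒¬T near1 {false} far ()

  near-everywhere : Near c a false → Near c a true → ∀ b → Near c a b
  near-everywhere near0 near1 false = near0
  near-everywhere near0 near1 true  = near1

module _ (f : A → Bool) {L : Weighted A} (0≤ws : NonNegWeights L) (total≡1 : total L ≡ 1ℚ) where

  private
    ones? : Decidable (λ x → T (f x))
    ones? x = T? (f x)

    mass-ones : mass ones? L ≡ mean f L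
    mass-ones = sym (mean≡mass f L)

    mass-zeros : mass (∁? ones?) L ≡ 1ℚ - mean f L
    mass-zeros = p+q≡r⇒q≡r-p {mean f L} {mass (∁? ones?) L} (begin
      mean f L + mass (∁? ones?) L      ≡⟨ cong (_+ mass (∁? ones?) L) (sym mass-ones) ⟩
      mass ones? L + mass (∁? ones?) L  ≡⟨ mass-+-mass-∁ ones? L ⟩
      total L                           ≡⟨ total≡1 ⟩
      1ℚ                                ∎)
      where open ≡-Reasoning

    mean-nonneg : 0ℚ ≤ℚ mean f L
    mean-nonneg = subst (0ℚ ≤ℚ_) mass-ones (mass-nonneg ones? 0≤ws)

    mean≤1 : mean f L ≤ℚ 1ℚ
    mean≤1 = subst₂ _≤ℚ_ mass-ones (trans (mass-+-mass-∁ ones? L) total≡1)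
                (p≤p+q (mass-nonneg (∁? ones?) 0≤ws))

    far-from-mean? : ∀ c → Decidable (λ x → Far c (mean f L) (f x))
    far-from-mean? c x = far? c (mean f L) (f x)

  mass-far< : 0ℚ <ℚ m → m ≤ℚ 1ℚ - m → mass (λ x → far? (1ℚ - m) (mean f L) (f x)) L <ℚ m
  mass-far< {m} 0<m m≤1-m with mean f L <? m
  ... | yes mean<m = begin-strict
    mass (far-from-mean? (1ℚ - m)) L
      ≤⟨ mass-mono (far-from-mean? _) ones? (far⇒T {mean f L} near0) 0≤ws ⟩
    mass ones? L
      ≡⟨ mass-ones ⟩
    mean f L
      <⟨ mean<m ⟩
    m ∎
    where
    open ≤-Reasoning
    near0 : Near (1ℚ - m) (mean f L) false
    near0 = near-false mean-nonneg (<⇒≤ (<-≤-trans mean<m m≤1-m))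
  ... | no mean≮m with mean f L ≤? 1ℚ - m
  ...   | yes mean≤1-m =
    subst (_<ℚ m) (sym (mass-∅ (far-from-mean? _) nothing-far L)) 0<m
    where
    near0 : Near (1ℚ - m) (mean f L) false
    near0 = near-false mean-nonneg mean≤1-m
    near1 : Near (1ℚ - m) (mean f L) true
    near1 = near-true (≮⇒≥ mean≮m) mean≤1
    nothing-far : Empty (λ x → Far (1ℚ - m) (mean f L) (f x))
    nothing-far x far = far (near-everywhere {mean f L} near0 near1 (f x))
  ...   | no mean≰1-m = begin-strict
    mass (far-from-mean? (1ℚ - m)) L
      ≤⟨ mass-mono (far-from-mean? _) (∁? ones?) (far⇒¬T {mean f L} near1) 0≤ws ⟩
    mass (∁? ones?) L
      ≡⟨ mass-zeros ⟩
    1ℚ - mean f L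
      <⟨ 1-q<p⇒1-p<q (≰⇒> mean≰1-m) ⟩
    m ∎
    where
    open ≤-Reasoning
    near1 : Near (1ℚ - m) (mean f L) true
    near1 = near-true (≮⇒≥ mean≮m) mean≤1

∑-mono-≤ : {f g : Fin n → ℚ} → (∀ i → f i ≤ℚ g i) → sum f ≤ℚ sum g
∑-mono-≤ {zero}  _   = ≤-refl
∑-mono-≤ {suc n} f≤g = +-mono-≤ (f≤g zero) (∑-mono-≤ (λ i → f≤g (suc i)))

∑-mono-< : .{{NonZero n}} → {f g : Fin n → ℚ} → (∀ i → f i <ℚ g i) → sum f <ℚ sum g
∑-mono-< {suc n} f<g = +-mono-<-≤ (f<g zero) (∑-mono-≤ (λ i → <⇒≤ (f<g (suc i))))

∑-nonneg : {f : Fin n → ℚ} → (∀ i → 0ℚ ≤ℚ f i) → 0ℚ ≤ℚ sum f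
∑-nonneg {n} {f} 0≤f = subst (_≤ℚ sum f) (sum-replicate-zero n) (∑-mono-≤ 0≤f)

≤-∑ : {f : Fin n → ℚ} → (∀ i → 0ℚ ≤ℚ f i) → ∀ i → f i ≤ℚ sum f
≤-∑ {suc n} {f} 0≤f i = begin
  f i                       ≤⟨ p≤p+q (∑-nonneg (λ j → 0≤f (punchIn i j))) ⟩
  f i + sum (removeAt f i)  ≡⟨ sum-remove f ⟨
  sum f                     ∎
  where open ≤-Reasoning

mass-union : {P : Fin n → Pred A ℓ} (P? : ∀ i → Decidable (P i)) {L : Weighted A} →
             NonNegWeights L → All (λ p → ∃ λ i → P i (proj₂ p)) L →
             total L ≤ℚ ∑[ i < n ] mass (P? i) L
mass-union {n} P? [] [] = ∑-nonneg {n} (λ _ → ≤-refl)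
mass-union {n} P? {(w , x) ∷ L} (0≤w ∷ 0≤ws) ((i , pix) ∷ covered) = begin
  w + total L
    ≤⟨ +-mono-≤ w≤∑ (mass-union P? 0≤ws covered) ⟩
  ∑[ j < n ] weight (P? j) (w , x) + ∑[ j < n ] mass (P? j) L
    ≡⟨ ∑-distrib-+ (λ j → weight (P? j) (w , x)) (λ j → mass (P? j) L) ⟨
  ∑[ j < n ] mass (P? j) ((w , x) ∷ L)
    ∎
  where
  open ≤-Reasoning
  w≤∑ : w ≤ℚ ∑[ j < n ] weight (P? j) (w , x)
  w≤∑ = subst (_≤ℚ _) (weight-∈ (P? i) pix) (≤-∑ (λ j → weight-nonneg (P? j) x 0≤w) i)

+-/ : ∀ i j k → i / suc k + j / suc k ≡ (i ℤ.+ j) / suc k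
+-/ i j k = toℚᵘ-injective (begin
  toℚᵘ (i / d + j / d)             ≈⟨ toℚᵘ-homo-+ (i / d) (j / d) ⟩
  toℚᵘ (i / d) ℚᵘ.+ toℚᵘ (j / d)   ≈⟨ ℚᵘ.+-cong (toℚᵘ-fromℚᵘ i/d) (toℚᵘ-fromℚᵘ j/d) ⟩
  i/d ℚᵘ.+ j/d                     ≈⟨ ℚᵘ.*≡* same-denominator ⟩
  ℚᵘ.mkℚᵘ (i ℤ.+ j) k              ≈⟨ toℚᵘ-fromℚᵘ _ ⟨
  toℚᵘ ((i ℤ.+ j) / d)             ∎)
  where
  open SetoidReasoning ℚᵘ.≃-setoid
  d : ℕ
  d = suc k
  i/d j/d : ℚᵘ.ℚᵘ
  i/d = ℚᵘ.mkℚᵘ i k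
  j/d = ℚᵘ.mkℚᵘ j k
  D : ℤ.ℤ
  D = + d
  same-denominator : (i ℤ.* D ℤ.+ j ℤ.* D) ℤ.* D ≡ (i ℤ.+ j) ℤ.* (D ℤ.* D)
  same-denominator =
    trans (cong (ℤ._* D) (sym (ℤ.*-distribʳ-+ D i j))) (ℤ.*-assoc (i ℤ.+ j) D D)

∑-inv : ∀ k j → ∑[ i < j ] inv (suc k) ≡ + j / suc k
∑-inv k zero    = sym (0/n≡0 (suc k))
∑-inv k (suc j) = trans (cong (_+_ (inv (suc k))) (∑-inv k j)) (+-/ (+ 1) (+ j) k)

∑-inv≡1 : ∀ k → ∑[ i < suc k ] inv (suc k) ≡ 1ℚ
∑-inv≡1 k = trans (∑-inv k (suc k))
  (fromℚᵘ-cong {ℚᵘ.mkℚᵘ (+ suc k) k} {ℚᵘ.mkℚᵘ (+ 1) 0} (ℚᵘ.*≡* (ℤ.*-comm (+ suc k) (+ 1))))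

inv-pos : ∀ k → 0ℚ <ℚ inv (suc k)
inv-pos k = positive⁻¹ (inv (suc k)) {{normalize-pos 1 (suc k)}}

∑≡1⇒p≤1-p : ∀ k → 0ℚ ≤ℚ p → ∑[ i < suc (suc k) ] p ≡ 1ℚ → p ≤ℚ 1ℚ - p
∑≡1⇒p≤1-p {p} k 0≤p ∑≡1 = p+p≤1⇒p≤1-p (begin
  p + p                       ≤⟨ +-monoʳ-≤ p (p≤p+q (∑-nonneg {k} (λ _ → 0≤p))) ⟩
  p + (p + ∑[ i < k ] p)      ≡⟨ ∑≡1 ⟩
  1ℚ                          ∎)
  where open ≤-Reasoning

hull-point-near-vertex : .{{NonZero n}} → {S : (Fin n → Bool) → Set} {x : Fin n → ℚ} →
                         0ℚ <ℚ m → m ≤ℚ 1ℚ - m → ∑[ i < n ] m ≤ℚ 1ℚ → InHull S x →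
                         Σ (Fin n → Bool) (λ v → S v × SupDistLe x (embed v) (1ℚ - m))
hull-point-near-vertex {n} {m} {S} {x} 0<m m≤1-m ∑m≤1 hull =
  [ ⊥-elim ∘ ¬all-far , close-vertex ]′ (search close? pts)
  where
  open InHull hull

  Close : Pred (ℚ × (Fin n → Bool)) 0ℓ
  Close (_ , v) = SupDistLe x (embed v) (1ℚ - m)

  close? : Decidable Close
  close? (_ , v) = all? (λ i → near? (1ℚ - m) (x i) (v i))

  close-vertex : Any Close pts → Σ (Fin n → Bool) (λ v → S v × SupDistLe x (embed v) (1ℚ - m))
  close-vertex some-close = let s , close = lookupAny inS some-close in _ , s , close

  far-in? : ∀ i → Decidable (λ v → Far (1ℚ - m) (x i) (v i))
  far-in? i v = far? (1ℚ - m) (x i) (v i)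

  some-far : ∀ {p} → ¬ Close p → ∃ λ i → Far (1ℚ - m) (x i) (proj₂ p i)
  some-far {_ , v} = ¬∀⟶∃¬ n _ (λ i → near? (1ℚ - m) (x i) (v i))

  mass-far<m : ∀ i → mass (far-in? i) pts <ℚ m
  mass-far<m i = subst (λ a → mass (λ v → far? (1ℚ - m) a (v i)) pts <ℚ m) (sym (comb i))
    (mass-far< (λ v → v i) nonneg sum1 0<m m≤1-m)

  ¬all-far : ¬ All (∁ Close) pts
  ¬all-far all-far = <-irrefl refl (begin-strict
    1ℚ
      ≡⟨ sum1 ⟨
    total pts
      ≤⟨ mass-union far-in? nonneg (All.map (λ {p} → some-far {p}) all-far) ⟩
    ∑[ i < n ] mass (far-in? i) pts
      <⟨ ∑-mono-< mass-far<m ⟩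
    ∑[ i < n ] m
      ≤⟨ ∑m≤1 ⟩
    1ℚ ∎)
    where open ≤-Reasoning

lemma4p1 : (n : ℕ) → 2 ≤ n → (S : (Fin n → Bool) → Set) → (x : Fin n → ℚ) →
    InHull S x →
    Σ (Fin n → Bool) (λ v → S v × SupDistLe x (embed v) (1ℚ - inv n))
lemma4p1 (suc (suc k)) (s≤s (s≤s z≤n)) S x =
  hull-point-near-vertex 0<m (∑≡1⇒p≤1-p k (<⇒≤ 0<m) ∑m≡1) (≤-reflexive ∑m≡1)
  where
  0<m : 0ℚ <ℚ inv (suc (suc k))
  0<m = inv-pos (suc k)
  ∑m≡1 : ∑[ i < suc (suc k) ] inv (suc (suc k)) ≡ 1ℚ
  ∑m≡1 = ∑-inv≡1 (suc k)
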